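{- Let $q=p^n$ where $p$ is a prime with $p\equiv 3\pmod 4$ and $n$ is odd, $V=\mathbb{F}_q^3$, $V_+=\{v_+\mid v\in V\}\leq\mathrm{Sym}(V)$ the group of translations $v_+:x\mapsto x+v$, $E=\{E(x)\mid x\in\mathbb{F}_q\}$ with $E(x)=\begin{pmatrix}1&x&x^2/2\\0&1&x\\0&0&1\end{pmatrix}$ acting on $V$ by left multiplication, and $F$ the group of maps $(x,y,z)^T\mapsto(f(x),f(y),f(z))^T$ for $f\in\mathrm{Gal}(\mathbb{F}_q/\mathbb{F}_p)$. If $g\in FEV_+\setminus V_+$, then the index of the centralizer $\mathbf{C}_{V_+}(g)$ in $V_+$ is at least $p^2$.
   Context: $FEV_+$ denotes the subgroup of $\mathrm{Sym}(V)$ consisting of products $fev_+$ with $f\in F$, $e\in E$, $v\in V$. -}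

module Defs where

open import Level using (0ℓ)
open import Data.Nat using (ℕ; _≤_) renaming (_^_ to _^ℕ_; _*_ to _*ℕ_)
open import Data.Fin using (Fin)
open import Data.Product using (_×_; _,_; Σ; ∃; proj₁)
open import Data.List using (List; length)
open import Data.List.Relation.Unary.All using (All)
open import Data.List.Relation.Unary.Unique.Propositional using (Unique)
open import Relation.Binary.PropositionalEquality using (_≡_; _≢_)
open import Function.Bundles using (_↔_)
open import Algebra.Structures using (IsCommutativeRing)

record FiniteField : Set₁ where
  field
    Carrier : Set
    _+_ _*_ : Carrier → Carrier → Carrier
    -_      : Carrier → Carrier
    0# 1#   : Carrier
    isCommutativeRing : IsCommutativeRing _≡_ _+_ _*_ -_ 0# 1#
    0≢1     : 0# ≢ 1#
    inv     : ∀ x → x ≢ 0# → Carrier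
    inv-law : ∀ x (nz : x ≢ 0#) → x * inv x nz ≡ 1#
    size    : ℕ
    enum    : Fin size ↔ Carrier
  infixl 6 _+_
  infixl 7 _*_

module _ (K : FiniteField) where
  open FiniteField K

  V : Set
  V = Carrier × Carrier × Carrier

  _+ᵥ_ : V → V → V
  (a , b , c) +ᵥ (a' , b' , c') = (a + a' , b + b' , c + c')

  trans₊ : V → V → V
  trans₊ v w = w +ᵥ v

  -- E(x) acting by left multiplication, where `half` is 1/2 in K
  -- (i.e. half * (1 + 1) ≡ 1), so that x^2/2 = x * x * half.
  Emat : (half : Carrier) → Carrier → V → V
  Emat half x (a , b , c) =
    (a + x * b + (x * x * half) * c , b + x * c , c)

  -- Elements of Gal(K / F_p): field automorphisms of K
  -- (these automatically fix the prime field).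
  record FieldAut : Set where
    field
      fun    : Carrier → Carrier
      bij    : ∃ λ (g : Carrier → Carrier) →
                 (∀ y → fun (g y) ≡ y) × (∀ y → g (fun y) ≡ y)
      pres-+ : ∀ x y → fun (x + y) ≡ fun x + fun y
      pres-* : ∀ x y → fun (x * y) ≡ fun x * fun y
      pres-1 : fun 1# ≡ 1#

  Fmap : FieldAut → V → V
  Fmap σ (a , b , c) = (f a , f b , f c) where f = FieldAut.fun σ

  -- g = f ∘ E(x) ∘ v₊  (the product f E(x) v₊ acting on the left)
  FEVelem : (half : Carrier) → FieldAut → Carrier → V → V → V
  FEVelem half σ x v w = Fmap σ (Emat half x (trans₊ v w))

  InV₊ : (V → V) → Set
  InV₊ g = ∃ λ u → ∀ w → g w ≡ trans₊ u w

  InCentralizer : (V → V) → V → Set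
  InCentralizer g u = ∀ w → trans₊ u (g w) ≡ g (trans₊ u w)

  -- |V₊ : C_{V₊}(g)| ≥ m, i.e. m * |C_{V₊}(g)| ≤ |V₊| = size^3,
  -- expressed as: every duplicate-free list of elements of the
  -- centralizer has length ℓ with ℓ * m ≤ size ^ 3.
  IndexAtLeast : (V → V) → ℕ → Set
  IndexAtLeast g m =
    ∀ (l : List V) → Unique l → All (InCentralizer g) l →
      length l *ℕ m ≤ size ^ℕ 3

module Submission where

-- A translation u₊ commutes with g = σ E(x) v₊ exactly when u is a fixed point of the
-- additive map ψ = σ ∘ E(x), so it suffices to show that ψ has at most q fixed points:
-- then |V₊ : C(g)| ≥ q³ / q = q² ≥ p². Let F be the fixed field of σ and r = |F|. Reading
-- ψ(a , b , c) = (a , b , c) from the last coordinate up, c ∈ F, and once c (resp. b and c)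
-- is fixed, b (resp. a) ranges over a coset of F; so ψ has at most r³ fixed points.
-- If σ ≠ 1, pick t ∉ F; then F + F t has r² elements, and since q = pⁿ with n odd is not
-- a square there is some s ∉ F + F t, so that F + F t + F s has r³ ≤ q elements.
-- If σ = 1, then x ≠ 0 (otherwise g is a translation) and the fixed points are the (a , 0 , 0).

open import Defs
open import Data.Nat using (ℕ; _^_; _%_)
open import Data.Nat.Primality using (Prime)
open import Relation.Binary.PropositionalEquality using (_≡_)
open import Relation.Nullary using (¬_)

open import Algebra.Bundles using (CommutativeRing)
open import Algebra.Structures using (IsCommutativeRing)
open import Data.Empty using (⊥-elim)
open import Data.Fin using () renaming (_≟_ to _≟Fin_)
open import Data.List using (List; []; _∷_; map; filter; length; allFin; cartesianProduct)
open import Data.List.Properties using (length-++; length-map; length-tabulate)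
open import Data.List.Membership.Propositional using (_∈_; find)
open import Data.List.Membership.Propositional.Properties
  using (∈-map⁺; ∈-allFin; ∈-filter⁺; ∈-filter⁻; ∈-cartesianProduct⁺; ∈-cartesianProduct⁻)
open import Data.List.Relation.Unary.All as All using (All; _∷_; all?)
import Data.List.Relation.Unary.All.Properties as All
open import Data.List.Relation.Unary.Any using (here; there)
open import Data.List.Relation.Unary.AllPairs using (_∷_)
open import Data.List.Relation.Unary.Unique.Propositional using (Unique)
import Data.List.Relation.Unary.Unique.Propositional.Properties as Unique
open import Data.Nat using (zero; suc; _≤_; z≤n; s≤s) renaming (_+_ to _+ℕ_; _*_ to _*ℕ_)
open import Data.Nat.Divisibility using (_∣_; divides; ∣1⇒≡1)
open import Data.Nat.Primality using (euclidsLemma; ¬prime[1]; prime⇒nonZero)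
open import Data.Nat.Properties
  using (+-mono-≤; *-mono-≤; ^-monoˡ-≤; *-identityʳ; +-suc; ≤-trans; ≤-antisym;
         *-cancelˡ-≡; *-comm; m≤m*n; m^n≢0; module ≤-Reasoning)
open import Data.Nat.Tactic.RingSolver using (solve-∀)
open import Data.Product using (_×_; _,_; proj₁; proj₂; ∃₂)
open import Data.Sum using ([_,_]′)
open import Function using (id; _∘_)
open import Function.Bundles using (Inverse; Injection)
open import Function.Properties.Inverse using (↔-sym; ↔⇒↣)
open import Relation.Nullary.Decidable using (via-injection)
open import Relation.Nullary using (Dec; yes; no; ¬?)
open import Relation.Binary.Definitions using (DecidableEquality)
open import Relation.Binary.PropositionalEquality
  using (_≢_; refl; sym; trans; cong; cong₂; subst; subst₂; module ≡-Reasoning)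

AtMost : {A : Set} → ℕ → (A → Set) → Set
AtMost {A} k P = ∀ (l : List A) → Unique l → All P l → length l ≤ k

module _ {A : Set} where

  atMost-⊆ : ∀ {k} {P Q : A → Set} → (∀ {a} → P a → Q a) → AtMost k Q → AtMost k P
  atMost-⊆ P⊆Q Q≤k l u al = Q≤k l u (All.map P⊆Q al)

  atMost-≤ : ∀ {k k′} {P : A → Set} → k ≤ k′ → AtMost k P → AtMost k′ P
  atMost-≤ k≤k′ P≤k l u al = ≤-trans (P≤k l u al) k≤k′

  atMost-1 : ∀ {P : A → Set} → (∀ {a b} → P a → P b → a ≡ b) → AtMost 1 P
  atMost-1 eq []          _               _             = z≤n
  atMost-1 eq (_ ∷ [])    _               _             = s≤s z≤n
  atMost-1 eq (_ ∷ _ ∷ _) ((a≢b ∷ _) ∷ _) (Pa ∷ Pb ∷ _) = ⊥-elim (a≢b (eq Pa Pb))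

  length-filter-split : ∀ {Q : A → Set} (Q? : ∀ a → Dec (Q a)) (l : List A) →
    length l ≡ length (filter Q? l) +ℕ length (filter (λ a → ¬? (Q? a)) l)
  length-filter-split Q? []      = refl
  length-filter-split Q? (a ∷ l) with Q? a
  ... | yes _ = cong suc (length-filter-split Q? l)
  ... | no  _ = trans (cong suc (length-filter-split Q? l)) (sym (+-suc _ _))

module _ {A B : Set} (_≟_ : DecidableEquality B) (π : A → B) where

  atMost-fibres : ∀ {k} {P : A → Set} (m : List B) → (∀ {a} → P a → π a ∈ m) →
    (∀ b → AtMost k (λ a → P a × π a ≡ b)) → AtMost (length m *ℕ k) P
  atMost-fibres []      P⇒∈m _ []      _ _        = z≤n
  atMost-fibres []      P⇒∈m _ (_ ∷ _) _ (Pa ∷ _) with () ← P⇒∈m Pa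
  atMost-fibres {k} {P} (b ∷ m) P⇒∈m fibre≤k l u al = begin
    length l                                              ≡⟨ length-filter-split over-b? l ⟩
    length (filter over-b? l) +ℕ length (filter off-b? l) ≤⟨ +-mono-≤ over-b≤k off-b≤ ⟩
    k +ℕ length m *ℕ k                                    ∎
    where
    open ≤-Reasoning
    over-b? : ∀ a → Dec (π a ≡ b)
    over-b? a = π a ≟ b
    off-b? : ∀ a → Dec (¬ π a ≡ b)
    off-b? a = ¬? (over-b? a)
    over-b≤k : length (filter over-b? l) ≤ k
    over-b≤k = fibre≤k b (filter over-b? l) (Unique.filter⁺ over-b? u)
      (All.zip (All.filter⁺ over-b? al , All.all-filter over-b? l))
    off-b⇒∈m : ∀ {a} → P a × ¬ π a ≡ b → π a ∈ m
    off-b⇒∈m (Pa , π≢b) with P⇒∈m Pa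
    ... | here π≡b  = ⊥-elim (π≢b π≡b)
    ... | there π∈m = π∈m
    off-b≤ : length (filter off-b? l) ≤ length m *ℕ k
    off-b≤ = atMost-fibres m off-b⇒∈m
      (λ b′ → atMost-⊆ (λ (Pa , π≡b′) → proj₁ Pa , π≡b′) (fibre≤k b′))
      (filter off-b? l) (Unique.filter⁺ off-b? u)
      (All.zip (All.filter⁺ off-b? al , All.all-filter off-b? l))

  atMost-injective : ∀ {P : A → Set} (m : List B) → (∀ {a} → P a → π a ∈ m) →
    (∀ {a a′} → P a → P a′ → π a ≡ π a′ → a ≡ a′) → AtMost (length m) P
  atMost-injective m P⇒∈m inj =
    subst (λ k → AtMost k _) (*-identityʳ (length m))
      (atMost-fibres m P⇒∈m λ b → atMost-1 λ (Pa , πa≡b) (Pa′ , πa′≡b) →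
        inj Pa Pa′ (trans πa≡b (sym πa′≡b)))

length-cartesianProduct : ∀ {A B : Set} (xs : List A) (ys : List B) →
  length (cartesianProduct xs ys) ≡ length xs *ℕ length ys
length-cartesianProduct []       ys = refl
length-cartesianProduct (x ∷ xs) ys =
  trans (length-++ (map (x ,_) ys)) (cong₂ _+ℕ_ (length-map (x ,_) ys) (length-cartesianProduct xs ys))

module FieldProperties (K : FiniteField) where

  open FiniteField K public
  open IsCommutativeRing isCommutativeRing public
    using (+-assoc; +-comm; +-identityˡ; +-identityʳ; -‿inverseˡ; *-identityˡ; zeroʳ)

  commutativeRing : CommutativeRing _ _
  commutativeRing = record { isCommutativeRing = isCommutativeRing }

  open import Algebra.Properties.AbelianGroup (CommutativeRing.+-abelianGroup commutativeRing) public
    using (∙-cancelˡ; ∙-cancelʳ; identityʳ-unique; inverseˡ-unique; x∙y⁻¹≈ε⇒x≈y; xyx⁻¹≈y; ⁻¹-∙-comm)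
  open import Algebra.Properties.Ring (CommutativeRing.ring commutativeRing) public
    using (-‿distribˡ-*)
  open import Algebra.Solver.Ring.NaturalCoefficients.Default
    (CommutativeRing.commutativeSemiring commutativeRing) public
    using (solve; _:=_; _:+_; _:*_; con)

  infixl 6 _-_
  _-_ : Carrier → Carrier → Carrier
  a - b = a + - b

  [x-y]+y≡x : ∀ a b → (a - b) + b ≡ a
  [x-y]+y≡x a b = trans (+-assoc a (- b) b) (trans (cong (a +_) (-‿inverseˡ b)) (+-identityʳ a))

  -‿distrib-+ : ∀ a b → - (a + b) ≡ - a + - b
  -‿distrib-+ a b = sym (⁻¹-∙-comm a b)

  inv-cancelˡ : ∀ c (c≢0 : c ≢ 0#) a → inv c c≢0 * (c * a) ≡ a
  inv-cancelˡ c c≢0 a = begin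
    inv c c≢0 * (c * a) ≡⟨ solve 3 (λ i c a → i :* (c :* a) := (c :* i) :* a) refl (inv c c≢0) c a ⟩
    (c * inv c c≢0) * a ≡⟨ cong (_* a) (inv-law c c≢0) ⟩
    1# * a              ≡⟨ *-identityˡ a ⟩
    a                   ∎
    where open ≡-Reasoning

  *-cancelˡ-≢0 : ∀ {a b} c → c ≢ 0# → c * a ≡ c * b → a ≡ b
  *-cancelˡ-≢0 {a} {b} c c≢0 e =
    trans (sym (inv-cancelˡ c c≢0 a)) (trans (cong (inv c c≢0 *_) e) (inv-cancelˡ c c≢0 b))

  x*y≡0⇒y≡0 : ∀ {a} c → c ≢ 0# → c * a ≡ 0# → a ≡ 0#
  x*y≡0⇒y≡0 c c≢0 e = *-cancelˡ-≢0 c c≢0 (trans e (sym (zeroʳ c)))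

  open Inverse enum using (to; from; strictlyInverseˡ)

  _≟_ : DecidableEquality Carrier
  _≟_ = via-injection (↔⇒↣ (↔-sym enum)) _≟Fin_

  elements : List Carrier
  elements = map to (allFin size)

  elements-unique : Unique elements
  elements-unique = Unique.map⁺ (Injection.injective (↔⇒↣ enum)) (Unique.allFin⁺ size)

  ∈-elements : ∀ a → a ∈ elements
  ∈-elements a = subst (_∈ elements) (strictlyInverseˡ a) (∈-map⁺ to (∈-allFin (from a)))

  length-elements : length elements ≡ size
  length-elements = trans (length-map to (allFin size)) (length-tabulate id)

  atMost-size : ∀ {A : Set} {P : A → Set} (π : A → Carrier) →
    (∀ {a a′} → P a → P a′ → π a ≡ π a′ → a ≡ a′) → AtMost size P
  atMost-size π inj = subst (λ k → AtMost k _) length-elements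
    (atMost-injective _≟_ π elements (λ {a} _ → ∈-elements (π a)) inj)

module FixedField (K : FiniteField) (σ : FieldAut K) where

  open FieldProperties K
  open FieldAut σ using (fun; pres-+; pres-*; pres-1)
  open import Data.List.Membership.DecPropositional _≟_ using (_∈?_)

  fun-0 : fun 0# ≡ 0#
  fun-0 = identityʳ-unique (fun 0#) (fun 0#)
    (trans (sym (pres-+ 0# 0#)) (cong fun (+-identityʳ 0#)))

  fun-neg : ∀ a → fun (- a) ≡ - fun a
  fun-neg a = inverseˡ-unique (fun (- a)) (fun a)
    (trans (sym (pres-+ (- a) a)) (trans (cong fun (-‿inverseˡ a)) fun-0))

  Fixed : Carrier → Set
  Fixed a = fun a ≡ a

  fixed-sub : ∀ {a b} → Fixed a → Fixed b → Fixed (a - b)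
  fixed-sub {a} {b} fa fb = trans (pres-+ a (- b)) (cong₂ _+_ fa (trans (fun-neg b) (cong -_ fb)))

  fixed-* : ∀ {a b} → Fixed a → Fixed b → Fixed (a * b)
  fixed-* {a} {b} fa fb = trans (pres-* a b) (cong₂ _*_ fa fb)

  fixed-inv : ∀ {a} (a≢0 : a ≢ 0#) → Fixed a → Fixed (inv a a≢0)
  fixed-inv {a} a≢0 fa = *-cancelˡ-≢0 a a≢0 (begin
    a * fun (inv a a≢0)     ≡⟨ cong (_* fun (inv a a≢0)) fa ⟨
    fun a * fun (inv a a≢0) ≡⟨ pres-* a (inv a a≢0) ⟨
    fun (a * inv a a≢0)     ≡⟨ cong fun (inv-law a a≢0) ⟩
    fun 1#                  ≡⟨ pres-1 ⟩
    1#                      ≡⟨ inv-law a a≢0 ⟨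
    a * inv a a≢0           ∎)
    where open ≡-Reasoning

  fixed-difference : ∀ {y y′ t} → fun (y + t) ≡ y → fun (y′ + t) ≡ y′ → Fixed (y - y′)
  fixed-difference {y} {y′} {t} e e′ = ∙-cancelʳ y′ (fun (y - y′)) (y - y′) (begin
    fun (y - y′) + y′           ≡⟨ cong (fun (y - y′) +_) e′ ⟨
    fun (y - y′) + fun (y′ + t) ≡⟨ pres-+ (y - y′) (y′ + t) ⟨
    fun ((y - y′) + (y′ + t))   ≡⟨ cong fun (+-assoc (y - y′) y′ t) ⟨
    fun ((y - y′) + y′ + t)     ≡⟨ cong (λ z → fun (z + t)) ([x-y]+y≡x y y′) ⟩
    fun (y + t)                 ≡⟨ e ⟩
    y                           ≡⟨ [x-y]+y≡x y y′ ⟨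
    (y - y′) + y′               ∎)
    where open ≡-Reasoning

  fixed? : ∀ a → Dec (Fixed a)
  fixed? a = fun a ≟ a

  fixedField : List Carrier
  fixedField = filter fixed? elements

  r : ℕ
  r = length fixedField

  fixedField-unique : Unique fixedField
  fixedField-unique = Unique.filter⁺ fixed? elements-unique

  ∈-fixedField⁺ : ∀ {a} → Fixed a → a ∈ fixedField
  ∈-fixedField⁺ {a} fa = ∈-filter⁺ fixed? (∈-elements a) fa

  ∈-fixedField⁻ : ∀ {a} → a ∈ fixedField → Fixed a
  ∈-fixedField⁻ a∈ = proj₂ (∈-filter⁻ fixed? {xs = elements} a∈)

  atMost-coset : ∀ {A : Set} {P : A → Set} {k} (π : A → Carrier) →
    (∀ {a a′} → P a → P a′ → Fixed (π a - π a′)) →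
    (∀ c → AtMost k (λ a → P a × π a ≡ c)) → AtMost (r *ℕ k) P
  atMost-coset π _ _ [] _ _ = z≤n
  atMost-coset {P = P} {k} π diff fibre≤k l@(a₀ ∷ _) u al@(Pa₀ ∷ _) =
    subst (λ n → length l ≤ n *ℕ k) (length-map (π a₀ +_) fixedField)
      (atMost-fibres _≟_ π (map (π a₀ +_) fixedField) ∈coset fibre≤k l u al)
    where
    ∈coset : ∀ {a} → P a → π a ∈ map (π a₀ +_) fixedField
    ∈coset {a} Pa = subst (_∈ map (π a₀ +_) fixedField)
      (trans (+-comm (π a₀) (π a - π a₀)) ([x-y]+y≡x (π a) (π a₀)))
      (∈-map⁺ (π a₀ +_) (∈-fixedField⁺ (diff Pa Pa₀)))

  record FixedSubspace (W : Carrier → Set) : Set where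
    field
      sub-closed : ∀ {a b} → W a → W b → W (a - b)
      *-closed : ∀ {c a} → Fixed c → W a → W (c * a)

  fixedField-subspace : FixedSubspace Fixed
  fixedField-subspace = record { sub-closed = fixed-sub ; *-closed = fixed-* }

  _⊕_ : (Carrier → Set) → Carrier → Carrier → Set
  (W ⊕ s) y = ∃₂ λ w c → W w × Fixed c × y ≡ w + c * s

  ⊕-subspace : ∀ {W s} → FixedSubspace W → FixedSubspace (W ⊕ s)
  ⊕-subspace {W} {s} S = record
    { sub-closed = λ { (w , c , Ww , fc , refl) (w′ , c′ , Ww′ , fc′ , refl) →
        w - w′ , c - c′ , sub-closed Ww Ww′ , fixed-sub fc fc′ , sub-lemma w c w′ c′ }
    ; *-closed = λ { {d} fd (w , c , Ww , fc , refl) →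
        d * w , d * c , *-closed fd Ww , fixed-* fd fc ,
        solve 4 (λ d w c s → d :* (w :+ c :* s) := d :* w :+ (d :* c) :* s) refl d w c s }
    }
    where
    open FixedSubspace S
    sub-lemma : ∀ w c w′ c′ → (w + c * s) - (w′ + c′ * s) ≡ (w - w′) + (c - c′) * s
    sub-lemma w c w′ c′ = begin
      (w + c * s) + - (w′ + c′ * s)     ≡⟨ cong ((w + c * s) +_) (-‿distrib-+ w′ (c′ * s)) ⟩
      (w + c * s) + (- w′ + - (c′ * s)) ≡⟨ cong (λ z → (w + c * s) + (- w′ + z)) (-‿distribˡ-* c′ s) ⟩
      (w + c * s) + (- w′ + (- c′) * s) ≡⟨ solve 5 (λ w c w̃ c̃ s →
                                              (w :+ c :* s) :+ (w̃ :+ c̃ :* s) := (w :+ w̃) :+ (c :+ c̃) :* s)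
                                            refl w c (- w′) (- c′) s ⟩
      (w - w′) + (c - c′) * s           ∎
      where open ≡-Reasoning

  ⊕-injective : ∀ {W s w w′ c c′} → FixedSubspace W → ¬ W s → W w → W w′ →
    Fixed c → Fixed c′ → w + c * s ≡ w′ + c′ * s → c ≡ c′ × w ≡ w′
  ⊕-injective {W} {s} {w} {w′} {c} {c′} S s∉W Ww Ww′ fc fc′ e with c ≟ c′
  ... | yes refl = refl , ∙-cancelʳ (c * s) w w′ e
  ... | no c≢c′ =
    ⊥-elim (s∉W (subst W s≡ (*-closed (fixed-inv d≢0 (fixed-sub fc fc′)) (sub-closed Ww′ Ww))))
    where
    open FixedSubspace S
    open ≡-Reasoning
    d = c - c′
    d≢0 : d ≢ 0#
    d≢0 d≡0 = c≢c′ (x∙y⁻¹≈ε⇒x≈y c c′ d≡0)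
    w+ds≡w′ : w + d * s ≡ w′
    w+ds≡w′ = ∙-cancelʳ (c′ * s) (w + d * s) w′ (begin
      w + d * s + c′ * s ≡⟨ solve 4 (λ w d s c′ → w :+ d :* s :+ c′ :* s := w :+ (d :+ c′) :* s) refl w d s c′ ⟩
      w + (d + c′) * s   ≡⟨ cong (λ z → w + z * s) ([x-y]+y≡x c c′) ⟩
      w + c * s          ≡⟨ e ⟩
      w′ + c′ * s        ∎)
    s≡ : inv d d≢0 * (w′ - w) ≡ s
    s≡ = begin
      inv d d≢0 * (w′ - w)        ≡⟨ cong (λ z → inv d d≢0 * (z - w)) w+ds≡w′ ⟨
      inv d d≢0 * (w + d * s - w) ≡⟨ cong (inv d d≢0 *_) (xyx⁻¹≈y w (d * s)) ⟩
      inv d d≢0 * (d * s)         ≡⟨ inv-cancelˡ d d≢0 s ⟩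
      s                           ∎

  ⊕-size-bound : ∀ {W s} {A : Set} → FixedSubspace W → ¬ W s →
    (e : A → Carrier) (as : List A) → Unique as → (∀ {a} → a ∈ as → W (e a)) →
    (∀ {a a′} → a ∈ as → a′ ∈ as → e a ≡ e a′ → a ≡ a′) → r *ℕ length as ≤ size
  ⊕-size-bound {W} {s} S s∉W e as as-unique W-e e-inj =
    subst (_≤ size) (length-cartesianProduct fixedField as)
      (atMost-size (λ (c , a) → e a + c * s) inj (cartesianProduct fixedField as)
        (Unique.cartesianProduct⁺ fixedField-unique as-unique)
        (All.tabulate λ ca∈ → let (c∈ , a∈) = ∈-cartesianProduct⁻ fixedField as ca∈
                              in ∈-fixedField⁻ c∈ , a∈))
    where
    inj : ∀ {ca ca′} → Fixed (proj₁ ca) × proj₂ ca ∈ as → Fixed (proj₁ ca′) × proj₂ ca′ ∈ as →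
      e (proj₂ ca) + proj₁ ca * s ≡ e (proj₂ ca′) + proj₁ ca′ * s → ca ≡ ca′
    inj (fc , a∈) (fc′ , a′∈) eq with ⊕-injective S s∉W (W-e a∈) (W-e a′∈) fc fc′ eq
    ... | refl , ea≡ = cong (_ ,_) (e-inj a∈ a′∈ ea≡)

  pairs : List (Carrier × Carrier)
  pairs = cartesianProduct fixedField fixedField

  ∈-pairs⁻ : ∀ {c w} → (c , w) ∈ pairs → Fixed c × Fixed w
  ∈-pairs⁻ cw∈ = let (c∈ , w∈) = ∈-cartesianProduct⁻ fixedField fixedField cw∈
                 in ∈-fixedField⁻ c∈ , ∈-fixedField⁻ w∈

  combine : Carrier → Carrier × Carrier → Carrier
  combine t (c , w) = w + c * t

  span : Carrier → List Carrier
  span t = map (combine t) pairs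

  length-span : ∀ t → length (span t) ≡ r *ℕ r
  length-span t = trans (length-map (combine t) pairs) (length-cartesianProduct fixedField fixedField)

  ∈-span⁺ : ∀ {t y} → (Fixed ⊕ t) y → y ∈ span t
  ∈-span⁺ {t} (w , c , fw , fc , refl) =
    ∈-map⁺ (combine t) (∈-cartesianProduct⁺ (∈-fixedField⁺ fc) (∈-fixedField⁺ fw))

  fixedField-square : ∀ {t} → ¬ Fixed t → r *ℕ r ≤ size
  fixedField-square t∉ =
    ⊕-size-bound fixedField-subspace t∉ id fixedField fixedField-unique ∈-fixedField⁻ (λ _ _ e → e)

  fixedField-cube : (∀ m → m *ℕ m ≢ size) → ∀ {t} → ¬ Fixed t → r *ℕ (r *ℕ r) ≤ size
  fixedField-cube nonsquare {t} t∉ with all? (_∈? span t) elements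
  ... | yes all∈span = ⊥-elim (nonsquare r (≤-antisym (fixedField-square t∉) size≤r*r))
    where
    size≤r*r : size ≤ r *ℕ r
    size≤r*r = subst₂ _≤_ length-elements (length-span t)
      (atMost-injective _≟_ id (span t) id (λ _ _ e → e) elements elements-unique all∈span)
  ... | no ¬all∈span
    with s , _ , s∉span ← find (All.¬All⇒Any¬ (_∈? span t) elements ¬all∈span) =
    subst (λ n → r *ℕ n ≤ size) (length-cartesianProduct fixedField fixedField)
      (⊕-size-bound (⊕-subspace fixedField-subspace) (s∉span ∘ ∈-span⁺) (combine t) pairs
        (Unique.cartesianProduct⁺ fixedField-unique fixedField-unique)
        (λ cw∈ → let (fc , fw) = ∈-pairs⁻ cw∈ in _ , _ , fw , fc , refl)
        combine-injective)
    where
    combine-injective : ∀ {cw cw′} → cw ∈ pairs → cw′ ∈ pairs →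
      combine t cw ≡ combine t cw′ → cw ≡ cw′
    combine-injective cw∈ cw′∈ eq with ∈-pairs⁻ cw∈ | ∈-pairs⁻ cw′∈
    ... | fc , fw | fc′ , fw′
      with refl , refl ← ⊕-injective fixedField-subspace t∉ fw fw′ fc fc′ eq = refl

module Centralizer (K : FiniteField) (half : FiniteField.Carrier K) (σ : FieldAut K)
                   (x : FiniteField.Carrier K) where

  open FieldProperties K
  open FixedField K σ
  open FieldAut σ using (fun; pres-+)

  infixl 6 _+V_
  _+V_ : V K → V K → V K
  _+V_ = _+ᵥ_ K

  0V : V K
  0V = 0# , 0# , 0#

  first second third : V K → Carrier
  first  = proj₁
  second = proj₁ ∘ proj₂
  third  = proj₂ ∘ proj₂

  ≡-by-coordinates : ∀ {u u′} → first u ≡ first u′ → second u ≡ second u′ →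
    third u ≡ third u′ → u ≡ u′
  ≡-by-coordinates e₁ e₂ e₃ = cong₂ _,_ e₁ (cong₂ _,_ e₂ e₃)

  +V-comm : ∀ u w → u +V w ≡ w +V u
  +V-comm _ _ = ≡-by-coordinates (+-comm _ _) (+-comm _ _) (+-comm _ _)

  +V-identityˡ : ∀ u → 0V +V u ≡ u
  +V-identityˡ _ = ≡-by-coordinates (+-identityˡ _) (+-identityˡ _) (+-identityˡ _)

  +V-cancelˡ : ∀ u w w′ → u +V w ≡ u +V w′ → w ≡ w′
  +V-cancelˡ u w w′ e = ≡-by-coordinates
    (∙-cancelˡ _ _ _ (cong first e)) (∙-cancelˡ _ _ _ (cong second e)) (∙-cancelˡ _ _ _ (cong third e))

  ψ : V K → V K
  ψ u = Fmap K σ (Emat K half x u)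

  Fmap-+ : ∀ u w → Fmap K σ (u +V w) ≡ Fmap K σ u +V Fmap K σ w
  Fmap-+ _ _ = ≡-by-coordinates (pres-+ _ _) (pres-+ _ _) (pres-+ _ _)

  Emat-+ : ∀ u w → Emat K half x (u +V w) ≡ Emat K half x u +V Emat K half x w
  Emat-+ (a , b , c) (a′ , b′ , c′) = ≡-by-coordinates
    (solve 8 (λ a b c a′ b′ c′ x q →
        (a :+ a′) :+ x :* (b :+ b′) :+ q :* (c :+ c′) := a :+ x :* b :+ q :* c :+ (a′ :+ x :* b′ :+ q :* c′))
      refl a b c a′ b′ c′ x (x * x * half))
    (solve 5 (λ b c b′ c′ x → (b :+ b′) :+ x :* (c :+ c′) := b :+ x :* c :+ (b′ :+ x :* c′))
      refl b c b′ c′ x)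
    refl

  ψ-+ : ∀ u w → ψ (u +V w) ≡ ψ u +V ψ w
  ψ-+ u w = trans (cong (Fmap K σ) (Emat-+ u w)) (Fmap-+ _ _)

  FixedPoint : V K → Set
  FixedPoint u = ψ u ≡ u

  centralizer⇒fixedPoint : ∀ {v u} → InCentralizer K (FEVelem K half σ x v) u → FixedPoint u
  centralizer⇒fixedPoint {v} {u} commutes = sym (+V-cancelˡ (ψ v) u (ψ u) (begin
    ψ v +V u               ≡⟨ cong (λ w → ψ w +V u) (+V-identityˡ v) ⟨
    ψ (0V +V v) +V u       ≡⟨ commutes 0V ⟩
    ψ (0V +V u +V v)       ≡⟨ cong (λ w → ψ (w +V v)) (+V-identityˡ u) ⟩
    ψ (u +V v)             ≡⟨ ψ-+ u v ⟩
    ψ u +V ψ v             ≡⟨ +V-comm (ψ u) (ψ v) ⟩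
    ψ v +V ψ u             ∎))
    where open ≡-Reasoning

  q : Carrier
  q = x * x * half

  fixedPoint-third : ∀ {u} → FixedPoint u → Fixed (third u)
  fixedPoint-third = cong third

  fixedPoint-second : ∀ {u c} → FixedPoint u → third u ≡ c → fun (second u + x * c) ≡ second u
  fixedPoint-second Pu refl = cong second Pu

  fixedPoint-first : ∀ {u b c} → FixedPoint u → third u ≡ c → second u ≡ b →
    fun (first u + (x * b + q * c)) ≡ first u
  fixedPoint-first {u} Pu refl refl =
    trans (cong fun (sym (+-assoc (first u) (x * second u) (q * third u)))) (cong first Pu)

  atMost-fixedPoints-r³ : AtMost (r *ℕ (r *ℕ r)) FixedPoint
  atMost-fixedPoints-r³ =
    subst (λ k → AtMost k FixedPoint) (cong (λ k → r *ℕ (r *ℕ k)) (*-identityʳ r)) (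
    atMost-coset third (λ Pu Pu′ → fixed-sub (fixedPoint-third Pu) (fixedPoint-third Pu′)) λ c →
    atMost-coset second (λ (Pu , ≡c) (Pu′ , ≡c′) →
      fixed-difference (fixedPoint-second Pu ≡c) (fixedPoint-second Pu′ ≡c′)) λ b →
    atMost-coset first (λ ((Pu , ≡c) , ≡b) ((Pu′ , ≡c′) , ≡b′) →
      fixed-difference (fixedPoint-first Pu ≡c ≡b) (fixedPoint-first Pu′ ≡c′ ≡b′)) λ a →
    atMost-1 λ (((_ , ≡c) , ≡b) , ≡a) (((_ , ≡c′) , ≡b′) , ≡a′) →
      ≡-by-coordinates (trans ≡a (sym ≡a′)) (trans ≡b (sym ≡b′)) (trans ≡c (sym ≡c′)))

  module Trivial (allFixed : ∀ a → Fixed a) where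

    Emat-0 : x ≡ 0# → ∀ u → Emat K half x u ≡ u
    Emat-0 refl (a , b , c) = ≡-by-coordinates
      (solve 4 (λ a b c h → a :+ con 0 :* b :+ (con 0 :* con 0 :* h) :* c := a) refl a b c half)
      (solve 2 (λ b c → b :+ con 0 :* c := b) refl b c)
      refl

    translation : x ≡ 0# → ∀ v → InV₊ K (FEVelem K half σ x v)
    translation x≡0 v = v , λ w →
      trans (≡-by-coordinates (allFixed _) (allFixed _) (allFixed _)) (Emat-0 x≡0 (w +V v))

    fixedPoint-axis : x ≢ 0# → ∀ {u} → FixedPoint u → second u ≡ 0# × third u ≡ 0#
    fixedPoint-axis x≢0 {a , b , c} Pu = b≡0 , c≡0
      where
      c≡0 : c ≡ 0#
      c≡0 = x*y≡0⇒y≡0 x x≢0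
        (identityʳ-unique b (x * c) (trans (sym (allFixed _)) (fixedPoint-second Pu refl)))
      b≡0 : b ≡ 0#
      b≡0 = x*y≡0⇒y≡0 x x≢0 (begin
        x * b              ≡⟨ solve 2 (λ x b → x :* b := x :* b :+ con 0) refl x b ⟩
        x * b + 0#         ≡⟨ cong (λ z → x * b + z) (trans (sym (zeroʳ q)) (cong (q *_) (sym c≡0))) ⟩
        x * b + q * c      ≡⟨ identityʳ-unique a _ (trans (sym (allFixed _)) (fixedPoint-first Pu refl refl)) ⟩
        0#                 ∎)
        where open ≡-Reasoning

    atMost-fixedPoints-axis : x ≢ 0# → AtMost size FixedPoint
    atMost-fixedPoints-axis x≢0 = atMost-size first λ Pu Pu′ a≡a′ →
      let (b≡0 , c≡0) = fixedPoint-axis x≢0 Pu ; (b′≡0 , c′≡0) = fixedPoint-axis x≢0 Pu′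
      in ≡-by-coordinates a≡a′ (trans b≡0 (sym b′≡0)) (trans c≡0 (sym c′≡0))

  atMost-fixedPoints : (∀ m → m *ℕ m ≢ size) → ∀ v → ¬ InV₊ K (FEVelem K half σ x v) →
    AtMost size FixedPoint
  atMost-fixedPoints nonsquare v g∉V₊ with all? fixed? elements
  ... | no ¬allFixed with t , _ , t∉ ← find (All.¬All⇒Any¬ fixed? elements ¬allFixed) =
    atMost-≤ (fixedField-cube nonsquare t∉) atMost-fixedPoints-r³
  ... | yes allFixed with x ≟ 0#
  ...   | yes x≡0 = ⊥-elim (g∉V₊ (translation x≡0 v))
    where open Trivial (λ a → All.lookup allFixed (∈-elements a))
  ...   | no x≢0 = atMost-fixedPoints-axis x≢0
    where open Trivial (λ a → All.lookup allFixed (∈-elements a))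

  atMost-centralizer : (∀ m → m *ℕ m ≢ size) → ∀ v → ¬ InV₊ K (FEVelem K half σ x v) →
    AtMost size (InCentralizer K (FEVelem K half σ x v))
  atMost-centralizer nonsquare v g∉V₊ =
    atMost-⊆ centralizer⇒fixedPoint (atMost-fixedPoints nonsquare v g∉V₊)

module PrimePowers where

  open import Data.Nat using (_*_)

  square-of-multiple : ∀ k p → (k * p) * (k * p) ≡ p * (p * (k * k))
  square-of-multiple = solve-∀

  prime∣square⇒∣ : ∀ {p} → Prime p → ∀ m → p ∣ m * m → p ∣ m
  prime∣square⇒∣ pp m p∣m² = [ id , id ]′ (euclidsLemma m m pp p∣m²)

  odd-power-nonsquare : ∀ {p} → Prime p → ∀ n → n % 2 ≡ 1 → ∀ m → m * m ≢ p ^ n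
  odd-power-nonsquare {p} pp (suc n) n-odd m m²≡pⁿ
    with divides k refl ← prime∣square⇒∣ pp m (divides (p ^ n) (trans m²≡pⁿ (*-comm p (p ^ n)))) =
    cofactor n n-odd (*-cancelˡ-≡ _ _ p (trans (sym (square-of-multiple k p)) m²≡pⁿ))
    where
    instance _ = prime⇒nonZero pp
    cofactor : ∀ n → suc n % 2 ≡ 1 → p * (k * k) ≢ p ^ n
    cofactor zero          _     e =
      ¬prime[1] (subst Prime (∣1⇒≡1 (divides (k * k) (trans (sym e) (*-comm p (k * k))))) pp)
    cofactor (suc (suc n)) n-odd e = odd-power-nonsquare pp (suc n) n-odd k (*-cancelˡ-≡ _ _ p e)

  p≤p^n : ∀ {p} → Prime p → ∀ n → n % 2 ≡ 1 → p ≤ p ^ n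
  p≤p^n pp (suc n) _ = m≤m*n _ _ {{m^n≢0 _ n {{prime⇒nonZero pp}}}}

open PrimePowers

proposition6p6 : (p n : ℕ) → Prime p → p % 4 ≡ 3 → n % 2 ≡ 1 →
    (K : FiniteField) → FiniteField.size K ≡ p ^ n →
    (half : FiniteField.Carrier K) →
    FiniteField._*_ K half (FiniteField._+_ K (FiniteField.1# K) (FiniteField.1# K)) ≡ FiniteField.1# K →
    (σ : FieldAut K) (x : FiniteField.Carrier K) (v : V K) →
    ¬ InV₊ K (FEVelem K half σ x v) →
    IndexAtLeast K (FEVelem K half σ x v) (p ^ 2)
proposition6p6 p n p-prime _ n-odd K size≡pⁿ half _ σ x v g∉V₊ l l-unique l-central =
  *-mono-≤ (atMost-centralizer nonsquare v g∉V₊ l l-unique l-central) (^-monoˡ-≤ 2 p≤size)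
  where
  open Centralizer K half σ x
  open FiniteField K using (size)
  nonsquare : ∀ m → m *ℕ m ≢ size
  nonsquare m m²≡size = odd-power-nonsquare p-prime n n-odd m (trans m²≡size size≡pⁿ)
  p≤size : p ≤ size
  p≤size = subst (p ≤_) (sym size≡pⁿ) (p≤p^n p-prime n n-odd)
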